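{- Let $T$ be a string of length $n$ and $1 \le i \le j < n$. If $\#\mathit{occ}_{T[i..j+1]}(\mathit{sqs}_{i,j+1}) = 2$, then there are three integers $p_l, p_s, q$ such that $i \le p_l \le p_s \le q < j+1$, $T[p_s..q] = \mathit{sqs}_{i,j+1}$ and $T[p_l..q] = \mathit{lrs}_{i,j+1}$. Also, the following hold: (a) if there is no $[s',t'] \in \mathsf{MUS}(T[i..j])$ with $t' = q+1$, then $[p_s, q+1] \in \mathsf{MUS}(T[i..j+1])$; (b) if there is no $[s',t'] \in \mathsf{MUS}(T[i..j])$ with $s' = p_l - 1$, and $p_l \ge i+1$, then $[p_l - 1, q] \in \mathsf{MUS}(T[i..j+1])$.
   Context: For a string $W$, $W[a..b]$ is the substring from position $a$ to position $b$ (empty if $a>b$). For strings $w,W$, $\#\mathit{occ}_W(w)$ is the number of positions at which $w$ occurs in $W$, with $\#\mathit{occ}_W(\varepsilon)=|W|+1$. A substring $w$ of $W$ is unique in $W$ if $\#\mathit{occ}_W(w)=1$, repeating if $\#\mathit{occ}_W(w)\ge 2$, quasi-unique if $1\le\#\mathit{occ}_W(w)\le 2$. For $1\le i\le j\le n$, $\mathsf{MUS}(T[i..j])$ is the set of intervals $[s,t]$ with $i\le s\le t\le j$ (positions refer to $T$) such that $T[s..t]$ is unique in $T[i..j]$ and both $T[s+1..t]$ and $T[s..t-1]$ are repeating in $T[i..j]$. $\mathit{lrs}_{i,j}$ is the longest suffix of $T[i..j]$ repeating in $T[i..j]$ (possibly empty); $\mathit{sqs}_{i,j}$ is the shortest non-empty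 suffix of $T[i..j]$ that is quasi-unique in $T[i..j]$. -}

module Defs where

open import Data.Nat using (ℕ; zero; suc; _+_; _∸_; _≤_; _<_; _≥_)
open import Data.List using (List; []; length; take; drop; filter; upTo)
open import Data.List.Properties using (≡-dec)
open import Data.Product using (_×_; ∃)
open import Relation.Binary.Definitions using (DecidableEquality)
open import Relation.Binary.PropositionalEquality using (_≡_; _≢_)
open import Relation.Nullary using (¬_)

module Strings {A : Set} (_≟_ : DecidableEquality A) where

  -- T[a..b], positions 1-based (a ≥ 1 assumed); empty if a > b.
  sub : List A → ℕ → ℕ → List A
  sub T a b = take (suc b ∸ a) (drop (a ∸ 1) T)

  -- #occ_W(w): number of positions k ∈ {0,…,|W|} at which w occurs in W.
  -- (For w = ε this gives |W|+1.)
  occ : List A → List A → ℕ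
  occ w W = length (filter (λ k → ≡-dec _≟_ (take (length w) (drop k W)) w)
                           (upTo (suc (length W))))

  Unique : List A → List A → Set
  Unique w W = occ w W ≡ 1

  Repeating : List A → List A → Set
  Repeating w W = occ w W ≥ 2

  QuasiUnique : List A → List A → Set
  QuasiUnique w W = 1 ≤ occ w W × occ w W ≤ 2

  Suffix : List A → List A → Set
  Suffix u W = ∃ λ k → drop k W ≡ u

  IsLrs : List A → List A → Set
  IsLrs W u = Suffix u W × Repeating u W
            × (∀ u′ → Suffix u′ W → Repeating u′ W → length u′ ≤ length u)

  IsSqs : List A → List A → Set
  IsSqs W v = Suffix v W × v ≢ [] × QuasiUnique v W
            × (∀ v′ → Suffix v′ W → v′ ≢ [] → QuasiUnique v′ W → length v ≤ length v′)

  IsMUS : List A → ℕ → ℕ → ℕ → ℕ → Set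
  IsMUS T i j s t = i ≤ s × s ≤ t × t ≤ j
                  × Unique (sub T s t) (sub T i j)
                  × Repeating (sub T (suc s) t) (sub T i j)
                  × Repeating (sub T s (t ∸ 1)) (sub T i j)

-- Let W = T[i..j+1] and W′ = T[i..j]. The sqs v occurs in W only at the end and at one earlier
-- place. Since v repeats, the lrs u is at least as long as v, so v is a suffix of u; the non-final
-- occurrence of u therefore carries the earlier v, u ends where that v ends, and u occurs only
-- twice as well. Extending the earlier v by one letter to the right (u by one letter to the left)
-- gives a unique string: a second occurrence would run past the end of W (would be a repeating
-- suffix of W longer than u). Dropping its first (last) letter leaves a repeating string, for
-- otherwise it would already be unique in W′; since every proper suffix of v occurs three times in
-- W and every proper prefix of u twice inside W′, shrinking it from the left (right) would then
-- produce a MUS of W′ ending at q + 1 (starting at p_l − 1), which hypothesis (a) (resp. (b)) excludes.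

module Submission where

open import Data.Nat
  using (ℕ; zero; suc; _+_; _∸_; _⊓_; _≤_; _≰_; _<_; z≤n; s≤s; _<?_; _≤?_) renaming (_≟_ to _≟ℕ_)
open import Data.Nat.Properties
open import Data.List using (List; []; _∷_; [_]; _++_; length; filter; upTo; take; drop)
open import Data.List.Properties
  using (length-++; filter-++; filter-accept; filter-reject; upTo-∷ʳ; ≡-dec;
         take-take; take-drop; take-all; length-take; length-drop; drop-drop; drop-all)
open import Relation.Binary.Definitions using (DecidableEquality)
open import Defs
open import Data.Product using (_×_; _,_; proj₁; proj₂; ∃-syntax)
open import Data.Sum using (_⊎_; inj₁; inj₂)
open import Function using (_∘_)
open import Relation.Binary.PropositionalEquality
  using (_≡_; _≢_; refl; sym; trans; cong; subst; module ≡-Reasoning)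
open import Relation.Nullary using (¬_; Dec; yes; no; contradiction)
open import Relation.Nullary.Decidable using (_×-dec_; ¬?; decidable-stable)
open import Relation.Unary using (Decidable)

countBelow : {P : ℕ → Set} → Decidable P → ℕ → ℕ
countBelow P? n = length (filter P? (upTo n))

_∖?_ : {P : ℕ → Set} → Decidable P → (a : ℕ) → Decidable (λ k → P k × k ≢ a)
(P? ∖? a) k = P? k ×-dec ¬? (k ≟ℕ a)

countBelow-suc : ∀ {P : ℕ → Set} (P? : Decidable P) n →
  countBelow P? (suc n) ≡ countBelow P? n + length (filter P? [ n ])
countBelow-suc P? n = begin
  length (filter P? (upTo (suc n)))             ≡⟨ cong (length ∘ filter P?) (sym (upTo-∷ʳ n)) ⟩
  length (filter P? (upTo n ++ [ n ]))           ≡⟨ cong length (filter-++ P? (upTo n) [ n ]) ⟩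
  length (filter P? (upTo n) ++ filter P? [ n ]) ≡⟨ length-++ (filter P? (upTo n)) ⟩
  countBelow P? n + length (filter P? [ n ])     ∎
  where open ≡-Reasoning

countBelow-accept : ∀ {P : ℕ → Set} (P? : Decidable P) {n} → P n → countBelow P? (suc n) ≡ suc (countBelow P? n)
countBelow-accept P? {n} p rewrite countBelow-suc P? n | filter-accept P? {xs = []} p = +-comm _ 1

countBelow-reject : ∀ {P : ℕ → Set} (P? : Decidable P) {n} → ¬ P n → countBelow P? (suc n) ≡ countBelow P? n
countBelow-reject P? {n} ¬p rewrite countBelow-suc P? n | filter-reject P? {xs = []} ¬p = +-identityʳ _

countBelow-witness : ∀ {P : ℕ → Set} (P? : Decidable P) {n} → 1 ≤ countBelow P? n → ∃[ k ] (k < n × P k)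
countBelow-witness P? {suc n} c with P? n
... | yes p = n , ≤-refl , p
... | no ¬p with countBelow-witness P? (subst (1 ≤_) (countBelow-reject P? ¬p) c)
...   | k , k<n , pk = k , m<n⇒m<1+n k<n , pk

countBelow-all : ∀ {P : ℕ → Set} (P? : Decidable P) → (∀ k → P k) → ∀ n → countBelow P? n ≡ n
countBelow-all P? all zero = refl
countBelow-all P? all (suc n) = trans (countBelow-accept P? (all n)) (cong suc (countBelow-all P? all n))

countBelow-∖-absent : ∀ {P : ℕ → Set} (P? : Decidable P) {a n} → (∀ {k} → k < n → P k → k ≢ a) →
  countBelow (P? ∖? a) n ≡ countBelow P? n
countBelow-∖-absent P? {a} {zero} _ = refl
countBelow-∖-absent {P} P? {a} {suc n} absent = step (P? n)
  where
  absent′ : ∀ {k} → k < n → P k → k ≢ a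
  absent′ k<n = absent (m<n⇒m<1+n k<n)
  step : Dec (P n) → countBelow (P? ∖? a) (suc n) ≡ countBelow P? (suc n)
  step (yes p) = trans (countBelow-accept (P? ∖? a) (p , absent ≤-refl p))
                       (trans (cong suc (countBelow-∖-absent P? absent′)) (sym (countBelow-accept P? p)))
  step (no ¬p) = trans (countBelow-reject (P? ∖? a) (¬p ∘ proj₁))
                       (trans (countBelow-∖-absent P? absent′) (sym (countBelow-reject P? ¬p)))

countBelow-∖ : ∀ {P : ℕ → Set} (P? : Decidable P) {a n} → P a → a < n →
  countBelow P? n ≡ suc (countBelow (P? ∖? a) n)
countBelow-∖ {P} P? {a} {suc n} pa a<1+n with m≤n⇒m<n∨m≡n (≤-pred a<1+n)
... | inj₂ refl = begin
  countBelow P? (suc a)              ≡⟨ countBelow-accept P? pa ⟩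
  suc (countBelow P? a)              ≡⟨ cong suc (countBelow-∖-absent P? {a} {a} (λ k<a _ → <⇒≢ k<a)) ⟨
  suc (countBelow (P? ∖? a) a)       ≡⟨ cong suc (countBelow-reject (P? ∖? a) λ (_ , a≢a) → a≢a refl) ⟨
  suc (countBelow (P? ∖? a) (suc a)) ∎
  where open ≡-Reasoning
... | inj₁ a<n = step (P? n)
  where
  step : Dec (P n) → countBelow P? (suc n) ≡ suc (countBelow (P? ∖? a) (suc n))
  step (yes p) = trans (countBelow-accept P? p)
    (cong suc (trans (countBelow-∖ P? pa a<n) (sym (countBelow-accept (P? ∖? a) (p , >⇒≢ a<n)))))
  step (no ¬p) = trans (countBelow-reject P? ¬p)
    (trans (countBelow-∖ P? pa a<n) (cong suc (sym (countBelow-reject (P? ∖? a) (¬p ∘ proj₁)))))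

countBelow-∖-≤ : ∀ {P : ℕ → Set} (P? : Decidable P) a n → countBelow P? n ≤ suc (countBelow (P? ∖? a) n)
countBelow-∖-≤ {P} P? a n with a <? n | P? a
... | yes a<n | yes pa = ≤-reflexive (countBelow-∖ P? pa a<n)
... | no a≮n  | _      =
  ≤-trans (≤-reflexive (sym (countBelow-∖-absent P? {a} {n} λ k<n _ k≡a → a≮n (subst (_< n) k≡a k<n))))
          (n≤1+n _)
... | yes _   | no ¬pa =
  ≤-trans (≤-reflexive (sym (countBelow-∖-absent P? {a} {n} λ _ pk k≡a → ¬pa (subst P k≡a pk)))) (n≤1+n _)

countBelow-≥1 : ∀ {P : ℕ → Set} (P? : Decidable P) {k n} → P k → k < n → 1 ≤ countBelow P? n
countBelow-≥1 P? pk k<n = subst (1 ≤_) (sym (countBelow-∖ P? pk k<n)) (s≤s z≤n)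

countBelow-≥2 : ∀ {P : ℕ → Set} (P? : Decidable P) {a b n} → P a → P b → a ≢ b → a < n → b < n →
  2 ≤ countBelow P? n
countBelow-≥2 P? pa pb a≢b a<n b<n = subst (2 ≤_) (sym (countBelow-∖ P? pa a<n))
  (s≤s (countBelow-≥1 (P? ∖? _) (pb , a≢b ∘ sym) b<n))

countBelow-other : ∀ {P : ℕ → Set} (P? : Decidable P) {n} → 2 ≤ countBelow P? n → ∀ a →
  ∃[ k ] (k < n × P k × k ≢ a)
countBelow-other P? {n} c a with countBelow-witness (P? ∖? a) (≤-pred (≤-trans c (countBelow-∖-≤ P? a n)))
... | k , k<n , pk , k≢a = k , k<n , pk , k≢a

countBelow-other₂ : ∀ {P : ℕ → Set} (P? : Decidable P) {n} → 3 ≤ countBelow P? n → ∀ a b →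
  ∃[ k ] (k < n × P k × k ≢ a × k ≢ b)
countBelow-other₂ P? {n} c a b
  with countBelow-witness ((P? ∖? a) ∖? b)
         (≤-pred (≤-pred (≤-trans c (≤-trans (countBelow-∖-≤ P? a n) (s≤s (countBelow-∖-≤ (P? ∖? a) b n))))))
... | k , k<n , (pk , k≢a) , k≢b = k , k<n , pk , k≢a , k≢b

countBelow-none : ∀ {P : ℕ → Set} (P? : Decidable P) {n} → (∀ {k} → k < n → ¬ P k) → countBelow P? n ≡ 0
countBelow-none P? {n} none with countBelow P? n in eq
... | zero = refl
... | suc _ with countBelow-witness P? (subst (1 ≤_) (sym eq) (s≤s z≤n))
...   | k , k<n , pk = contradiction pk (none k<n)

countBelow-≡1 : ∀ {P : ℕ → Set} (P? : Decidable P) {a n} → P a → a < n → (∀ {k} → k < n → P k → k ≡ a) →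
  countBelow P? n ≡ 1
countBelow-≡1 P? pa a<n only = trans (countBelow-∖ P? pa a<n)
  (cong suc (countBelow-none (P? ∖? _) λ k<n (pk , k≢a) → k≢a (only k<n pk)))

countBelow-≤2 : ∀ {P : ℕ → Set} (P? : Decidable P) {a b n} → (∀ {k} → k < n → P k → k ≡ a ⊎ k ≡ b) →
  countBelow P? n ≤ 2
countBelow-≤2 P? {a} {b} {n} two = begin
  countBelow P? n                                ≤⟨ countBelow-∖-≤ P? a n ⟩
  suc (countBelow (P? ∖? a) n)                   ≤⟨ s≤s (countBelow-∖-≤ (P? ∖? a) b n) ⟩
  suc (suc (countBelow ((P? ∖? a) ∖? b) n))      ≡⟨ cong (2 +_) (countBelow-none ((P? ∖? a) ∖? b) neither) ⟩
  2                                              ∎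
  where
  open ≤-Reasoning
  neither : ∀ {k} → k < n → ¬ ((_ × k ≢ a) × k ≢ b)
  neither k<n ((pk , k≢a) , k≢b) with two k<n pk
  ... | inj₁ k≡a = k≢a k≡a
  ... | inj₂ k≡b = k≢b k≡b

countBelow-≤2⇒either : ∀ {P : ℕ → Set} (P? : Decidable P) {a b k n} → countBelow P? n ≤ 2 →
  P a → P b → a ≢ b → a < n → b < n → P k → k < n → k ≡ a ⊎ k ≡ b
countBelow-≤2⇒either {P} P? {a} {b} {k} {n} c pa pb a≢b a<n b<n pk k<n with k ≟ℕ a | k ≟ℕ b
... | yes k≡a | _       = inj₁ k≡a
... | no _    | yes k≡b = inj₂ k≡b
... | no k≢a  | no k≢b  = contradiction c (<⇒≱ three)
  where
  pk′ : P k × k ≢ a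
  pk′ = pk , k≢a
  three : 3 ≤ countBelow P? n
  three = begin
    3                                         ≤⟨ +-monoʳ-≤ 2 (countBelow-≥1 ((P? ∖? a) ∖? b) (pk′ , k≢b) k<n) ⟩
    suc (suc (countBelow ((P? ∖? a) ∖? b) n)) ≡⟨ cong suc (countBelow-∖ (P? ∖? a) (pb , a≢b ∘ sym) b<n) ⟨
    suc (countBelow (P? ∖? a) n)              ≡⟨ countBelow-∖ P? pa a<n ⟨
    countBelow P? n                           ∎
    where open ≤-Reasoning

m+n≡o⇒m≡o∸n : ∀ {m n o} → m + n ≡ o → m ≡ o ∸ n
m+n≡o⇒m≡o∸n {m} {n} refl = sym (m+n∸n≡m m n)

boundary : ∀ {Q : ℕ → Set} → Decidable Q → ∀ {n} → Q 0 → ¬ Q n → ∃[ k ] (k < n × Q k × ¬ Q (suc k))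
boundary Q? {zero} q0 ¬qn = contradiction q0 ¬qn
boundary Q? {suc n} q0 ¬qn with Q? n
... | yes qn = n , ≤-refl , qn , ¬qn
... | no ¬qn′ with boundary Q? q0 ¬qn′
...   | k , k<n , qk , ¬qk′ = k , m<n⇒m<1+n k<n , qk , ¬qk′

-- Factors and occurrences

module _ {A : Set} where

  factor : List A → ℕ → ℕ → List A
  factor W k L = take L (drop k W)

  factor-take : ∀ {n k L} (W : List A) → k + L ≤ n → factor (take n W) k L ≡ factor W k L
  factor-take {n} {zero} {L} W L≤n = trans (take-take L n W) (cong (λ m → take m W) (m≤n⇒m⊓n≡m L≤n))
  factor-take {suc n} {suc k} (x ∷ W) (s≤s k+L≤n) = factor-take W k+L≤n
  factor-take {suc n} {suc k} [] _ = refl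

  length-factor : ∀ (W : List A) {k L} → k + L ≤ length W → length (factor W k L) ≡ L
  length-factor W {k} {L} k+L≤ = begin
    length (take L (drop k W))    ≡⟨ length-take L (drop k W) ⟩
    L ⊓ length (drop k W)         ≡⟨ cong (L ⊓_) (length-drop k W) ⟩
    L ⊓ (length W ∸ k)            ≡⟨ m≤n⇒m⊓n≡m (m+n≤o⇒m≤o∸n L (subst (_≤ length W) (+-comm k L) k+L≤)) ⟩
    L                             ∎
    where open ≡-Reasoning

  factor-factor : ∀ (W : List A) {k L o L′} → o + L′ ≤ L → factor (factor W k L) o L′ ≡ factor W (o + k) L′
  factor-factor W {k} {L} {o} {L′} o+L′≤L = begin
    factor (take L (drop k W)) o L′  ≡⟨ factor-take (drop k W) o+L′≤L ⟩
    take L′ (drop o (drop k W))      ≡⟨ cong (take L′) (drop-drop k o W) ⟩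
    take L′ (drop (k + o) W)         ≡⟨ cong (λ p → factor W p L′) (+-comm k o) ⟩
    factor W (o + k) L′              ∎
    where open ≡-Reasoning

  take-factor : ∀ (W : List A) {k L l} → l ≤ L → take l (factor W k L) ≡ factor W k l
  take-factor W {k} {L} {l} l≤L = trans (take-take l L (drop k W)) (cong (factor W k) (m≤n⇒m⊓n≡m l≤L))

  drop-factor : ∀ (W : List A) {k L o} → o ≤ L → drop o (factor W k L) ≡ factor W (o + k) (L ∸ o)
  drop-factor W {k} {L} {o} o≤L = begin
    drop o (take L (drop k W))              ≡⟨ cong (λ m → drop o (take m (drop k W))) (m+[n∸m]≡n o≤L) ⟨
    drop o (take (o + (L ∸ o)) (drop k W))  ≡⟨ take-drop (L ∸ o) o (drop k W) ⟨
    take (L ∸ o) (drop o (drop k W))        ≡⟨ cong (take (L ∸ o)) (drop-drop k o W) ⟩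
    factor W (k + o) (L ∸ o)                ≡⟨ cong (λ p → factor W p (L ∸ o)) (+-comm k o) ⟩
    factor W (o + k) (L ∸ o)                ∎
    where open ≡-Reasoning

  length-nonempty : ∀ {xs : List A} → xs ≢ [] → 0 < length xs
  length-nonempty {[]} xs≢[] = contradiction refl xs≢[]
  length-nonempty {_ ∷ _} _ = s≤s z≤n

  record OccursAt (w W : List A) (k : ℕ) : Set where
    constructor occurs
    field
      fits    : k + length w ≤ length W
      matches : factor W k (length w) ≡ w

  open OccursAt public

  factor-occursAt : ∀ (W : List A) {k L} → k + L ≤ length W → OccursAt (factor W k L) W k
  factor-occursAt W {k} {L} k+L≤ =
    occurs (subst (λ m → k + m ≤ length W) (sym |x|≡L) k+L≤) (cong (factor W k) |x|≡L)
    where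
    |x|≡L : length (factor W k L) ≡ L
    |x|≡L = length-factor W k+L≤

  occursAt-factor : ∀ {w W : List A} {k} → OccursAt w W k → ∀ {o L} → o + L ≤ length w →
    factor W (o + k) L ≡ factor w o L
  occursAt-factor {w} {W} (occurs _ w≡) {o} {L} o+L≤ =
    trans (sym (factor-factor W o+L≤)) (cong (λ x → factor x o L) w≡)

  occursAt-subfactor : ∀ {w W : List A} {k} → OccursAt w W k → ∀ {o L} → o + L ≤ length w →
    OccursAt (factor w o L) W (o + k)
  occursAt-subfactor {w} {W} {k} occ@(occurs fit _) {o} {L} o+L≤ =
    subst (λ x → OccursAt x W (o + k)) (occursAt-factor occ o+L≤) (factor-occursAt W fit′)
    where
    fit′ : o + k + L ≤ length W
    fit′ = begin
      o + k + L    ≡⟨ cong (_+ L) (+-comm o k) ⟩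
      k + o + L    ≡⟨ +-assoc k o L ⟩
      k + (o + L)  ≤⟨ +-monoʳ-≤ k o+L≤ ⟩
      k + length w ≤⟨ fit ⟩
      length W     ∎
      where open ≤-Reasoning

  occursAt-take : ∀ {w W : List A} {k n} → OccursAt w W k → k + length w ≤ n → OccursAt w (take n W) k
  occursAt-take {w} {W} {k} {n} (occurs fit w≡) k+|w|≤n =
    occurs (subst (_ ≤_) (sym (length-take n W)) (⊓-glb k+|w|≤n fit)) (trans (factor-take W k+|w|≤n) w≡)

  occursAt-untake : ∀ {w W : List A} {k n} → OccursAt w (take n W) k → OccursAt w W k
  occursAt-untake {w} {W} {k} {n} (occurs fit w≡) =
    occurs (≤-trans fit′ (m⊓n≤n n (length W)))
           (trans (sym (factor-take W (≤-trans fit′ (m⊓n≤m n (length W))))) w≡)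
    where
    fit′ : k + length w ≤ n ⊓ length W
    fit′ = subst (_ ≤_) (length-take n W) fit

module _ {A : Set} (_≟_ : DecidableEquality A) where
  open Strings _≟_

  -- occ w W is, by definition, countBelow (occurs? w W) (suc (length W)).
  occurs? : (w W : List A) → Decidable (λ k → factor W k (length w) ≡ w)
  occurs? w W k = ≡-dec _≟_ (factor W k (length w)) w

  private
    occursAt-< : ∀ {w W : List A} {k} → OccursAt w W k → k < suc (length W)
    occursAt-< {k = k} (occurs fit _) = s≤s (m+n≤o⇒m≤o k fit)

    occurs⇒occursAt : ∀ {w W : List A} {k} → k < suc (length W) → factor W k (length w) ≡ w → OccursAt w W k
    occurs⇒occursAt {w} {W} {k} (s≤s k≤) w≡ = occurs fit w≡
      where
      fit : k + length w ≤ length W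
      fit = begin
        k + length w                              ≡⟨ cong (λ x → k + length x) w≡ ⟨
        k + length (take (length w) (drop k W))   ≤⟨ +-monoʳ-≤ k |take|≤ ⟩
        k + length (drop k W)                     ≡⟨ cong (k +_) (length-drop k W) ⟩
        k + (length W ∸ k)                        ≡⟨ m+[n∸m]≡n k≤ ⟩
        length W                                  ∎
        where
        open ≤-Reasoning
        |take|≤ : length (take (length w) (drop k W)) ≤ length (drop k W)
        |take|≤ = subst (_≤ _) (sym (length-take (length w) (drop k W))) (m⊓n≤n _ _)

  occ-≥1 : ∀ {w W : List A} {k} → OccursAt w W k → 1 ≤ occ w W
  occ-≥1 {w} {W} o = countBelow-≥1 (occurs? w W) {n = suc (length W)} (matches o) (occursAt-< o)

  occ-≥2 : ∀ {w W : List A} {a b} → OccursAt w W a → OccursAt w W b → a ≢ b → Repeating w W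
  occ-≥2 {w} {W} oa ob a≢b = countBelow-≥2 (occurs? w W) {n = suc (length W)} (matches oa) (matches ob) a≢b
    (occursAt-< oa) (occursAt-< ob)

  occ-≡1 : ∀ {w W : List A} {a} → OccursAt w W a → (∀ {k} → OccursAt w W k → k ≡ a) → Unique w W
  occ-≡1 {w} {W} oa only =
    countBelow-≡1 (occurs? w W) {n = suc (length W)} (matches oa) (occursAt-< oa)
      (λ k< w≡ → only (occurs⇒occursAt k< w≡))

  occ-≤2 : ∀ {w W : List A} {a b} → (∀ {k} → OccursAt w W k → k ≡ a ⊎ k ≡ b) → occ w W ≤ 2
  occ-≤2 {w} {W} {a} {b} two =
    countBelow-≤2 (occurs? w W) {a} {b} {suc (length W)} (λ k< w≡ → two (occurs⇒occursAt k< w≡))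

  occ-≤2⇒either : ∀ {w W : List A} {a b k} → occ w W ≤ 2 → OccursAt w W a → OccursAt w W b → a ≢ b →
    OccursAt w W k → k ≡ a ⊎ k ≡ b
  occ-≤2⇒either {w} {W} c oa ob a≢b ok = countBelow-≤2⇒either (occurs? w W) {n = suc (length W)} c
    (matches oa) (matches ob) a≢b (occursAt-< oa) (occursAt-< ob) (matches ok) (occursAt-< ok)

  repeating⇒other : ∀ {w W : List A} → Repeating w W → ∀ a → ∃[ k ] (OccursAt w W k × k ≢ a)
  repeating⇒other {w} {W} rep a with countBelow-other (occurs? w W) {suc (length W)} rep a
  ... | k , k< , w≡ , k≢a = k , occurs⇒occursAt k< w≡ , k≢a

  occ-≥3⇒other₂ : ∀ {w W : List A} → 3 ≤ occ w W → ∀ a b → ∃[ k ] (OccursAt w W k × k ≢ a × k ≢ b)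
  occ-≥3⇒other₂ {w} {W} c a b with countBelow-other₂ (occurs? w W) {suc (length W)} c a b
  ... | k , k< , w≡ , k≢a , k≢b = k , occurs⇒occursAt k< w≡ , k≢a , k≢b

  occ-[] : ∀ W → occ [] W ≡ suc (length W)
  occ-[] W = countBelow-all (occurs? [] W) (λ _ → refl) (suc (length W))

  ¬unique⇒repeating : ∀ {w W : List A} {k} → OccursAt w W k → ¬ Unique w W → Repeating w W
  ¬unique⇒repeating o ¬u = ≤∧≢⇒< (occ-≥1 o) (¬u ∘ sym)

  []-¬unique : ∀ {W : List A} → 0 < length W → ¬ Unique [] W
  []-¬unique {W} 0<|W| u = <⇒≢ 0<|W| (sym (suc-injective (trans (sym (occ-[] W)) u)))

  repeating-untake : ∀ {w W : List A} {n} → Repeating w (take n W) → Repeating w W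
  repeating-untake {w} {W} {n} rep with repeating⇒other {w} {take n W} rep 0
  ... | a , oa , _ with repeating⇒other {w} {take n W} rep a
  ...   | b , ob , b≢a = occ-≥2 {w} {W} (occursAt-untake oa) (occursAt-untake ob) (b≢a ∘ sym)

  suffix-occursAt : ∀ {w W : List A} → Suffix w W → OccursAt w W (length W ∸ length w)
  suffix-occursAt {w} {W} suf@(d , drop-d≡w) =
    occurs (≤-reflexive (m∸n+n≡m |w|≤|W|))
           (trans (cong (take (length w)) drop-end≡w) (take-all (length w) w ≤-refl))
    where
    |w|≡ : length w ≡ length W ∸ d
    |w|≡ = trans (cong length (sym drop-d≡w)) (length-drop d W)
    |w|≤|W| : length w ≤ length W
    |w|≤|W| = subst (_≤ length W) (sym |w|≡) (m∸n≤m (length W) d)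
    drop-end≡w : drop (length W ∸ length w) W ≡ w
    drop-end≡w with d ≤? length W
    ... | yes d≤ = trans (cong (λ p → drop p W) (trans (cong (length W ∸_) |w|≡) (m∸[m∸n]≡n d≤))) drop-d≡w
    ... | no d≰ = trans (drop-all _ W (≤-reflexive (cong (λ x → length W ∸ length x) (sym w≡[])))) (sym w≡[])
      where
      w≡[] : w ≡ []
      w≡[] = trans (sym drop-d≡w) (drop-all d W (<⇒≤ (≰⇒> d≰)))

  factor-suffix : ∀ (W : List A) {k L} → k + L ≡ length W → Suffix (factor W k L) W
  factor-suffix W {k} {L} k+L≡ =
    k , sym (take-all L (drop k W)
              (≤-reflexive (trans (length-drop k W) (trans (cong (_∸ k) (sym k+L≡)) (m+n∸m≡n k L)))))

  occursAt-end⇒suffix : ∀ {w W : List A} {k} → OccursAt w W k → k + length w ≡ length W → Suffix w W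
  occursAt-end⇒suffix {w} {W} o end = subst (λ x → Suffix x W) (matches o) (factor-suffix W end)

  suffix-end : ∀ {w W : List A} → Suffix w W → length W ∸ length w + length w ≡ length W
  suffix-end {w} {W} suf = m∸n+n≡m (m+n≤o⇒n≤o (length W ∸ length w) (fits (suffix-occursAt suf)))

  suffix-drop : ∀ {w W : List A} → Suffix w W → ∀ o → Suffix (drop o w) W
  suffix-drop {w} {W} (d , drop-d≡w) o = d + o , trans (sym (drop-drop d o W)) (cong (drop o) drop-d≡w)

  -- Minimal unique substrings

  -- [k, k + l] ∈ MUS(W), positions of W counted from 0.
  MinimalUnique : List A → ℕ → ℕ → Set
  MinimalUnique W k l = k + suc l ≤ length W × Unique (factor W k (suc l)) W
                      × Repeating (factor W (suc k) l) W × Repeating (factor W k l) W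

  unique? : (W : List A) → Decidable (λ w → Unique w W)
  unique? W w = occ w W ≟ℕ 1

  mus-starting-at : ∀ {W : List A} {a l} → a + suc l ≤ length W → Unique (factor W a (suc l)) W →
    (∀ {l′} → l′ ≤ l → Repeating (take l′ (factor W (suc a) l)) W) → ∃[ l′ ] MinimalUnique W a l′
  mus-starting-at {W} {a} {l} fit uniq rep
    with boundary (λ l′ → ¬? (unique? W (factor W a l′))) {suc l}
                  ([]-¬unique {W} (≤-trans (s≤s z≤n) (m+n≤o⇒n≤o a fit))) (λ ¬u → ¬u uniq)
  ... | l′ , l′<1+l , ¬u , ¬¬u =
    l′ , fit′ , decidable-stable (unique? W (factor W a (suc l′))) ¬¬u ,
    subst (λ w → Repeating w W) (take-factor W {suc a} (≤-pred l′<1+l)) (rep (≤-pred l′<1+l)) ,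
    ¬unique⇒repeating (factor-occursAt W {a} {l′} (≤-trans (+-monoʳ-≤ a (n≤1+n l′)) fit′)) ¬u
    where
    fit′ : a + suc l′ ≤ length W
    fit′ = ≤-trans (+-monoʳ-≤ a l′<1+l) fit

  mus-ending-at : ∀ {W : List A} {a l} → a + suc l ≤ length W → Unique (factor W a (suc l)) W →
    (∀ {o} → o ≤ l → Repeating (drop o (factor W a l)) W) →
    ∃[ s ] ∃[ l′ ] (MinimalUnique W s l′ × s + suc l′ ≡ a + suc l)
  mus-ending-at {W} {a} {l} fit uniq rep =
    conclude (boundary (λ o → unique? W (factor W (o + a) (suc l ∸ o))) uniq ¬unique-end)
    where
    ¬unique-end : ¬ Unique (factor W (suc l + a) (suc l ∸ suc l)) W
    ¬unique-end = subst (λ L → ¬ Unique (factor W (suc l + a) L) W) (sym (n∸n≡0 l))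
                        ([]-¬unique {W} (≤-trans (s≤s z≤n) (m+n≤o⇒n≤o a fit)))

    conclude : ∃[ o ] (o < suc l × Unique (factor W (o + a) (suc l ∸ o)) W
                       × ¬ Unique (factor W (suc o + a) (l ∸ o)) W) →
      ∃[ s ] ∃[ l′ ] (MinimalUnique W s l′ × s + suc l′ ≡ a + suc l)
    conclude (o , o<1+l , u , ¬u) =
      o + a , l ∸ o ,
      (≤-trans (≤-reflexive end) fit ,
       subst (λ L → Unique (factor W (o + a) L) W) (+-∸-assoc 1 o≤l) u ,
       ¬unique⇒repeating (factor-occursAt W {suc (o + a)} {l ∸ o} fit′) ¬u ,
       subst (λ w → Repeating w W) (drop-factor W o≤l) (rep o≤l)) ,
      end
      where
      o≤l : o ≤ l
      o≤l = ≤-pred o<1+l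
      end : o + a + suc (l ∸ o) ≡ a + suc l
      end = begin
        o + a + suc (l ∸ o)   ≡⟨ cong (_+ suc (l ∸ o)) (+-comm o a) ⟩
        a + o + suc (l ∸ o)   ≡⟨ +-assoc a o (suc (l ∸ o)) ⟩
        a + (o + suc (l ∸ o)) ≡⟨ cong (a +_) (+-suc o (l ∸ o)) ⟩
        a + suc (o + (l ∸ o)) ≡⟨ cong (λ m → a + suc m) (m+[n∸m]≡n o≤l) ⟩
        a + suc l             ∎
        where open ≡-Reasoning
      fit′ : suc (o + a) + (l ∸ o) ≤ length W
      fit′ = ≤-trans (≤-reflexive (trans (sym (+-suc (o + a) (l ∸ o))) end)) fit

  -- Extensions of the lrs and the sqs

  <⇒≢suffix-position : ∀ {w W : List A} {k} → Suffix w W → k + length w < length W → k ≢ length W ∸ length w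
  <⇒≢suffix-position {w} suf k+|w|<|W| refl = <⇒≢ k+|w|<|W| (suffix-end suf)

  right-extension-unique : ∀ {w W : List A} {k} → occ w W ≤ 2 → Suffix w W → OccursAt w W k →
    k + length w < length W → Unique (factor W k (suc (length w))) W
  right-extension-unique {w} {W} {k} occ≤2 suf ok k+|w|<|W| = occ-≡1 (factor-occursAt W fit) only
    where
    fit : k + suc (length w) ≤ length W
    fit = subst (_≤ length W) (sym (+-suc k (length w))) k+|w|<|W|
    prefix-occurs : ∀ {k′} → OccursAt (factor W k (suc (length w))) W k′ → OccursAt w W k′
    prefix-occurs {k′} o = subst (λ x → OccursAt x W k′)
      (trans (factor-factor W {k = k} {o = 0} (n≤1+n _)) (matches ok))
      (occursAt-subfactor o (subst (length w ≤_) (sym (length-factor W fit)) (n≤1+n _)))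
    only : ∀ {k′} → OccursAt (factor W k (suc (length w))) W k′ → k′ ≡ k
    only o with occ-≤2⇒either occ≤2 ok (suffix-occursAt suf) (<⇒≢suffix-position suf k+|w|<|W|)
                               (prefix-occurs o)
    ... | inj₁ k′≡k = k′≡k
    ... | inj₂ refl = contradiction (fits o) λ too-long → 1+n≰n (subst (_≤ length W) past-end too-long)
      where
      past-end : length W ∸ length w + length (factor W k (suc (length w))) ≡ suc (length W)
      past-end = trans (cong (length W ∸ length w +_) (length-factor W fit))
                       (trans (+-suc _ (length w)) (cong suc (suffix-end suf)))

  lrs-left-extension-unique : ∀ {u W : List A} {k} → IsLrs W u → occ u W ≤ 2 → OccursAt u W (suc k) →
    suc k + length u < length W → Unique (factor W k (suc (length u))) W
  lrs-left-extension-unique {u} {W} {k} (suf , _ , longest) occ≤2 ok 1+k+|u|<|W| =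
    occ-≡1 (factor-occursAt W fit) only
    where
    x = factor W k (suc (length u))
    fit : k + suc (length u) ≤ length W
    fit = subst (_≤ length W) (sym (+-suc k (length u))) (<⇒≤ 1+k+|u|<|W|)
    |x|≡ : length x ≡ suc (length u)
    |x|≡ = length-factor W fit
    1+k≢ku : suc k ≢ length W ∸ length u
    1+k≢ku = <⇒≢suffix-position suf 1+k+|u|<|W|
    suffix-occurs : ∀ {k′} → OccursAt x W k′ → OccursAt u W (suc k′)
    suffix-occurs {k′} o = subst (λ y → OccursAt y W (suc k′))
      (trans (factor-factor W {k = k} {o = 1} ≤-refl) (matches ok))
      (occursAt-subfactor o (≤-reflexive (sym |x|≡)))
    -- An occurrence of u right after k′ at the end of W would make x a repeating suffix longer than u.
    only : ∀ {k′} → OccursAt x W k′ → k′ ≡ k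
    only {k′} o with occ-≤2⇒either occ≤2 ok (suffix-occursAt suf) 1+k≢ku (suffix-occurs o)
    ... | inj₁ 1+k′≡1+k = suc-injective 1+k′≡1+k
    ... | inj₂ 1+k′≡ku = contradiction (longest x x-suffix x-repeating) (subst (_≰ length u) (sym |x|≡) (n≮n _))
      where
      x-suffix : Suffix x W
      x-suffix = occursAt-end⇒suffix o (begin
        k′ + length x          ≡⟨ cong (k′ +_) |x|≡ ⟩
        k′ + suc (length u)    ≡⟨ +-suc k′ (length u) ⟩
        suc k′ + length u      ≡⟨ cong (_+ length u) 1+k′≡ku ⟩
        length W ∸ length u + length u ≡⟨ suffix-end suf ⟩
        length W               ∎)
        where open ≡-Reasoning
      x-repeating : Repeating x W
      x-repeating = occ-≥2 o (factor-occursAt W fit) λ k′≡k → 1+k≢ku (trans (cong suc (sym k′≡k)) 1+k′≡ku)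

  module _ {W : List A} {n} (|W|≡1+n : length W ≡ suc n) where

    length-init : length (take n W) ≡ n
    length-init = trans (length-take n W) (m≤n⇒m⊓n≡m (subst (n ≤_) (sym |W|≡1+n) (n≤1+n n)))

    occursAt-init : ∀ {w k} → OccursAt w W k → k + length w ≢ length W → OccursAt w (take n W) k
    occursAt-init o ≢|W| = occursAt-take o (≤-pred (subst (_ <_) |W|≡1+n (≤∧≢⇒< (fits o) ≢|W|)))

    factor-occursAt-init : ∀ {k L} → k + L ≤ n → OccursAt (factor W k L) (take n W) k
    factor-occursAt-init {k} {L} k+L≤n = subst (λ w → OccursAt w (take n W) k) (factor-take W k+L≤n)
      (factor-occursAt (take n W) (subst (k + L ≤_) (sym length-init) k+L≤n))

    suffix-occ≥3⇒repeating-init : ∀ {y} → Suffix y W → 3 ≤ occ y W → Repeating y (take n W)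
    suffix-occ≥3⇒repeating-init {y} suf c
      with repeating⇒other {y} {W} (≤-trans (n≤1+n 2) c) (length W ∸ length y)
    ... | k₁ , o₁ , k₁≢p with occ-≥3⇒other₂ {y} {W} c (length W ∸ length y) k₁
    ...   | k₂ , o₂ , k₂≢p , k₂≢k₁ =
      occ-≥2 (occursAt-init o₂ (k₂≢p ∘ m+n≡o⇒m≡o∸n)) (occursAt-init o₁ (k₁≢p ∘ m+n≡o⇒m≡o∸n)) k₂≢k₁

    sqs-shorter-suffix-occ≥3 : ∀ {v y} → 1 ≤ n → IsSqs W v → Suffix y W → length y < length v → 3 ≤ occ y W
    sqs-shorter-suffix-occ≥3 {y = []} 1≤n _ _ _ =
      subst (3 ≤_) (sym (trans (occ-[] W) (cong suc |W|≡1+n))) (s≤s (s≤s 1≤n))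
    sqs-shorter-suffix-occ≥3 {y = c ∷ y} _ (_ , _ , _ , shortest) suf shorter =
      ≰⇒> λ occ≤2 → <⇒≱ shorter (shortest (c ∷ y) suf (λ ()) (occ-≥1 (suffix-occursAt suf) , occ≤2))

    sqs-proper-suffix-repeating : ∀ {x v} → 1 ≤ n → IsSqs W (x ∷ v) → ∀ o → Repeating (drop o v) (take n W)
    sqs-proper-suffix-repeating {x} {v} 1≤n sqs@(suf , _) o = suffix-occ≥3⇒repeating-init suf′
      (sqs-shorter-suffix-occ≥3 1≤n sqs suf′ (s≤s |drop|≤))
      where
      |drop|≤ : length (drop o v) ≤ length v
      |drop|≤ = subst (_≤ length v) (sym (length-drop o v)) (m∸n≤m (length v) o)
      suf′ : Suffix (drop o v) W
      suf′ = suffix-drop suf (suc o)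

    proper-prefix-repeating : ∀ {w a b} → OccursAt w W a → OccursAt w W b → a ≢ b →
      ∀ {l} → l < length w → Repeating (take l w) (take n W)
    proper-prefix-repeating {w} oa ob a≢b {l} l<|w| = occ-≥2 (prefix-init oa) (prefix-init ob) a≢b
      where
      prefix-init : ∀ {k} → OccursAt w W k → OccursAt (take l w) (take n W) k
      prefix-init {k} o = occursAt-init (occursAt-subfactor o (<⇒≤ l<|w|))
        (subst (λ m → k + m ≢ length W) (sym (length-factor w (<⇒≤ l<|w|)))
               (<⇒≢ (≤-trans (+-monoʳ-< k l<|w|) (fits o))))

    -- If the shifted copy were unique in take n W, shrinking it from the left along the repeating
    -- proper suffixes of v would give a MUS of take n W ending at k + length v.
    sqs-shifted-right-repeating : ∀ {v k} → IsSqs W v → occ v W ≡ 2 → OccursAt v W k → k + length v < length W →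
      ¬ (∃[ s ] ∃[ l ] (MinimalUnique (take n W) s l × s + suc l ≡ suc (k + length v))) →
      Repeating (factor W (suc k) (length v)) W
    sqs-shifted-right-repeating {[]} (_ , v≢[] , _) = contradiction refl v≢[]
    sqs-shifted-right-repeating {v@(_ ∷ v′)} {k} sqs@(suf , _) occ≡2 ok k+|v|<|W| no-mus
      with suc k + length v ≟ℕ length W
    ... | yes at-end = subst (λ w → Repeating w W) (sym shifted≡v) (≤-reflexive (sym occ≡2))
      where
      shifted≡v : factor W (suc k) (length v) ≡ v
      shifted≡v = trans (cong (λ p → factor W p (length v)) (m+n≡o⇒m≡o∸n {suc k} at-end))
                        (matches (suffix-occursAt suf))
    ... | no ¬at-end = repeating-untake {factor W (suc k) (length v)} {W} {n}
                         (¬unique⇒repeating (factor-occursAt-init {suc k} {length v} in-init) ¬unique)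
      where
      in-init : suc k + length v ≤ n
      in-init = ≤-pred (subst (_ <_) |W|≡1+n (≤∧≢⇒< k+|v|<|W| ¬at-end))
      tail≡v′ : factor (take n W) (suc k) (length v′) ≡ v′
      tail≡v′ = begin
        factor (take n W) (suc k) (length v′) ≡⟨ factor-take W (≤-trans (+-monoʳ-≤ (suc k) (n≤1+n _)) in-init) ⟩
        factor W (1 + k) (length v′)          ≡⟨ occursAt-factor ok ≤-refl ⟩
        take (length v′) v′                   ≡⟨ take-all (length v′) v′ ≤-refl ⟩
        v′                                    ∎
        where open ≡-Reasoning
      ¬unique : ¬ Unique (factor W (suc k) (length v)) (take n W)
      ¬unique uniq = no-mus (mus-ending-at {take n W} {suc k} {length v′}
        (subst (_ ≤_) (sym length-init) in-init)
        (subst (λ w → Unique w (take n W)) (sym (factor-take {k = suc k} {L = length v} W in-init)) uniq)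
        λ {o} _ → subst (λ w → Repeating (drop o w) (take n W)) (sym tail≡v′)
                    (sqs-proper-suffix-repeating (≤-trans (s≤s z≤n) in-init) sqs o))

    -- Symmetrically, since the proper prefixes of u repeat in take n W, a unique copy there would
    -- start a MUS of take n W at k.
    lrs-shifted-left-repeating : ∀ {u k} → Suffix u W → OccursAt u W (suc k) → suc k + length u < length W →
      ¬ (∃[ l ] MinimalUnique (take n W) k l) → Repeating (factor W k (length u)) W
    lrs-shifted-left-repeating {[]} _ _ 1+k<|W| _ =
      subst (2 ≤_) (sym (occ-[] W)) (s≤s (≤-trans (s≤s z≤n) 1+k<|W|))
    lrs-shifted-left-repeating {u@(_ ∷ u′)} {k} suf ok 1+k+|u|<|W| no-mus =
      repeating-untake {factor W k (length u)} {W} {n}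
        (¬unique⇒repeating (factor-occursAt-init {k} {length u} in-init) ¬unique)
      where
      in-init : k + length u ≤ n
      in-init = ≤-pred (≤-trans (n≤1+n _) (subst (_ <_) |W|≡1+n 1+k+|u|<|W|))
      prefix≡ : ∀ {l′} → l′ ≤ length u′ → take l′ (factor (take n W) (suc k) (length u′)) ≡ take l′ u
      prefix≡ {l′} l′≤ = begin
        take l′ (factor (take n W) (suc k) (length u′)) ≡⟨ take-factor (take n W) {suc k} l′≤ ⟩
        factor (take n W) (suc k) l′                    ≡⟨ factor-take W fit ⟩
        factor W (0 + suc k) l′                         ≡⟨ occursAt-factor ok (≤-trans l′≤ (n≤1+n _)) ⟩
        take l′ u                                       ∎
        where
        open ≡-Reasoning
        fit : suc k + l′ ≤ n
        fit = ≤-trans (+-monoʳ-≤ (suc k) l′≤) (subst (_≤ n) (+-suc k (length u′)) in-init)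
      ¬unique : ¬ Unique (factor W k (length u)) (take n W)
      ¬unique uniq = no-mus (mus-starting-at {take n W} {k} {length u′} (subst (_ ≤_) (sym length-init) in-init)
        (subst (λ w → Unique w (take n W)) (sym (factor-take {n = n} {k = k} {L = length u} W in-init)) uniq)
        λ {l′} l′≤ → subst (λ w → Repeating w (take n W)) (sym (prefix≡ l′≤))
          (proper-prefix-repeating ok (suffix-occursAt suf) (<⇒≢suffix-position suf 1+k+|u|<|W|) (s≤s l′≤)))

    sqs-right-extension-mus : ∀ {v k} → IsSqs W v → occ v W ≡ 2 → OccursAt v W k → k + length v < length W →
      ¬ (∃[ s ] ∃[ l ] (MinimalUnique (take n W) s l × s + suc l ≡ suc (k + length v))) →
      MinimalUnique W k (length v)
    sqs-right-extension-mus {v} {k} sqs occ≡2 ok k+|v|<|W| no-mus =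
      subst (_≤ length W) (sym (+-suc k (length v))) k+|v|<|W| ,
      right-extension-unique (≤-reflexive occ≡2) (proj₁ sqs) ok k+|v|<|W| ,
      sqs-shifted-right-repeating sqs occ≡2 ok k+|v|<|W| no-mus ,
      subst (λ w → Repeating w W) (sym (matches ok)) (≤-reflexive (sym occ≡2))

    lrs-left-extension-mus : ∀ {u k} → IsLrs W u → occ u W ≤ 2 → OccursAt u W (suc k) →
      suc k + length u < length W → ¬ (∃[ l ] MinimalUnique (take n W) k l) → MinimalUnique W k (length u)
    lrs-left-extension-mus {u} {k} lrs occ≤2 ok 1+k+|u|<|W| no-mus =
      subst (_≤ length W) (sym (+-suc k (length u))) (<⇒≤ 1+k+|u|<|W|) ,
      lrs-left-extension-unique lrs occ≤2 ok 1+k+|u|<|W| ,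
      subst (λ w → Repeating w W) (sym (matches ok)) (proj₁ (proj₂ lrs)) ,
      lrs-shifted-left-repeating (proj₁ lrs) ok 1+k+|u|<|W| no-mus

  lrs-sqs-layout : ∀ {W u v : List A} → IsLrs W u → IsSqs W v → occ v W ≡ 2 →
    ∃[ k₁ ] ∃[ k₀ ] (OccursAt u W k₁ × OccursAt v W k₀ × k₁ ≤ k₀ × k₀ + length v ≡ k₁ + length u
                     × k₀ + length v < length W × occ u W ≤ 2)
  lrs-sqs-layout {W} {u} {v} (sufu , repu , longest) (sufv , _) occ≡2
    with repeating⇒other {u} {W} repu (length W ∸ length u)
  ... | k₁ , ok₁ , k₁≢ku =
    k₁ , d + k₁ , ok₁ , v-after ok₁ , m≤n+m k₁ d , ends , ≤∧≢⇒< (fits (v-after ok₁)) (k₀≢kv ∘ m+n≡o⇒m≡o∸n) ,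
    occ-≤2 λ o → either (v-after o)
    where
    d = length u ∸ length v
    |v|≤|u| : length v ≤ length u
    |v|≤|u| = longest v sufv (≤-reflexive (sym occ≡2))
    d+|v|≡|u| : d + length v ≡ length u
    d+|v|≡|u| = m∸n+n≡m |v|≤|u|
    okv : OccursAt v W (length W ∸ length v)
    okv = suffix-occursAt sufv
    d+ku≡kv : d + (length W ∸ length u) ≡ length W ∸ length v
    d+ku≡kv = m+n≡o⇒m≡o∸n (begin
      d + (length W ∸ length u) + length v   ≡⟨ cong (_+ length v) (+-comm d _) ⟩
      length W ∸ length u + d + length v     ≡⟨ +-assoc (length W ∸ length u) d (length v) ⟩
      length W ∸ length u + (d + length v)   ≡⟨ cong (length W ∸ length u +_) d+|v|≡|u| ⟩
      length W ∸ length u + length u         ≡⟨ suffix-end sufu ⟩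
      length W                               ∎)
      where open ≡-Reasoning
    v-after : ∀ {k} → OccursAt u W k → OccursAt v W (d + k)
    v-after {k} o = subst (λ w → OccursAt w W (d + k)) v-in-u (occursAt-subfactor o (≤-reflexive d+|v|≡|u|))
      where
      v-in-u : factor u d (length v) ≡ v
      v-in-u = trans (sym (occursAt-factor (suffix-occursAt sufu) (≤-reflexive d+|v|≡|u|)))
                     (trans (cong (λ p → factor W p (length v)) d+ku≡kv) (matches okv))
    k₀≢kv : d + k₁ ≢ length W ∸ length v
    k₀≢kv k₀≡kv = k₁≢ku (+-cancelˡ-≡ d k₁ _ (trans k₀≡kv (sym d+ku≡kv)))
    ends : d + k₁ + length v ≡ k₁ + length u
    ends = begin
      d + k₁ + length v    ≡⟨ cong (_+ length v) (+-comm d k₁) ⟩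
      k₁ + d + length v    ≡⟨ +-assoc k₁ d (length v) ⟩
      k₁ + (d + length v)  ≡⟨ cong (k₁ +_) d+|v|≡|u| ⟩
      k₁ + length u        ∎
      where open ≡-Reasoning
    either : ∀ {k} → OccursAt v W (d + k) → k ≡ k₁ ⊎ k ≡ length W ∸ length u
    either {k} o with occ-≤2⇒either (≤-reflexive occ≡2) (v-after ok₁) okv k₀≢kv o
    ... | inj₁ d+k≡k₀ = inj₁ (+-cancelˡ-≡ d k k₁ d+k≡k₀)
    ... | inj₂ d+k≡kv = inj₂ (+-cancelˡ-≡ d k _ (trans d+k≡kv (sym d+ku≡kv)))

  -- Windows of T

  length-sub≤ : ∀ (T : List A) i₀ j → length (sub T (suc i₀) j) ≤ j ∸ i₀
  length-sub≤ T i₀ j = subst (_≤ j ∸ i₀) (sym (length-take (j ∸ i₀) (drop i₀ T))) (m⊓n≤m _ _)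

  sub-factor : ∀ (T : List A) {i₀ j k L s t} → s ≡ suc i₀ + k → suc t ≡ s + L →
    k + L ≤ length (sub T (suc i₀) j) → sub T s t ≡ factor (sub T (suc i₀) j) k L
  sub-factor T {i₀} {j} {k} {L} {s} {t} refl 1+t≡s+L fit = begin
    take (suc t ∸ s) (drop (i₀ + k) T) ≡⟨ cong (λ m → take m (drop (i₀ + k) T)) 1+t∸s≡L ⟩
    take L (drop (i₀ + k) T)           ≡⟨ cong (take L) (drop-drop i₀ k T) ⟨
    factor (drop i₀ T) k L             ≡⟨ factor-take (drop i₀ T) (≤-trans fit (length-sub≤ T i₀ j)) ⟨
    factor (sub T (suc i₀) j) k L      ∎
    where
    open ≡-Reasoning
    1+t∸s≡L : suc t ∸ s ≡ L
    1+t∸s≡L = trans (cong (_∸ s) 1+t≡s+L) (m+n∸m≡n s L)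

  minimalUnique⇒IsMUS : ∀ (T : List A) {i₀ j k l s t} → MinimalUnique (sub T (suc i₀) j) k l →
    s ≡ suc i₀ + k → t ≡ s + l → IsMUS T (suc i₀) j s t
  minimalUnique⇒IsMUS T {i₀} {j} {k} {l} (fit , uniq , rep-tail , rep-init) refl refl =
    m≤m+n (suc i₀) k , m≤m+n _ l , t≤j ,
    subst (λ w → Unique w W) (sym (in-W {k} {suc l} refl (sym (+-suc _ l)) fit)) uniq ,
    subst (λ w → Repeating w W)
          (sym (in-W {suc k} {l} (sym (+-suc (suc i₀) k)) refl (subst (_≤ length W) (+-suc k l) fit)))
          rep-tail ,
    subst (λ w → Repeating w W) (sym (in-W {k} {l} refl refl (≤-trans (+-monoʳ-≤ k (n≤1+n l)) fit))) rep-init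
    where
    W = sub T (suc i₀) j
    in-W : ∀ {k L s t} → s ≡ suc i₀ + k → suc t ≡ s + L → k + L ≤ length W → sub T s t ≡ factor W k L
    in-W = sub-factor T
    fit′ : suc (k + l) ≤ j ∸ i₀
    fit′ = subst (_≤ j ∸ i₀) (+-suc k l) (≤-trans fit (length-sub≤ T i₀ j))
    t≤j : suc i₀ + k + l ≤ j
    t≤j = begin
      suc i₀ + k + l       ≡⟨ +-assoc (suc i₀) k l ⟩
      suc (i₀ + (k + l))   ≡⟨ +-suc i₀ (k + l) ⟨
      i₀ + suc (k + l)     ≤⟨ +-monoʳ-≤ i₀ fit′ ⟩
      i₀ + (j ∸ i₀)        ≡⟨ m+[n∸m]≡n {i₀} (<⇒≤ (m∸n≢0⇒n<m (>⇒≢ (≤-trans (s≤s z≤n) fit′)))) ⟩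
      j                    ∎
      where open ≤-Reasoning

  module _ (T : List A) {i₀ j} (i₀≤j : i₀ ≤ j) (j<|T| : j < length T) where

    length-window : length (sub T (suc i₀) (suc j)) ≡ suc (j ∸ i₀)
    length-window = begin
      length (take (suc j ∸ i₀) (drop i₀ T)) ≡⟨ length-take _ (drop i₀ T) ⟩
      (suc j ∸ i₀) ⊓ length (drop i₀ T)      ≡⟨ cong ((suc j ∸ i₀) ⊓_) (length-drop i₀ T) ⟩
      (suc j ∸ i₀) ⊓ (length T ∸ i₀)         ≡⟨ m≤n⇒m⊓n≡m (∸-monoˡ-≤ i₀ j<|T|) ⟩
      suc j ∸ i₀                             ≡⟨ +-∸-assoc 1 i₀≤j ⟩
      suc (j ∸ i₀)                           ∎
      where open ≡-Reasoning

    window-init : sub T (suc i₀) j ≡ take (j ∸ i₀) (sub T (suc i₀) (suc j))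
    window-init = sym (trans (take-take (j ∸ i₀) (suc j ∸ i₀) (drop i₀ T))
                             (cong (λ m → take m (drop i₀ T)) (m≤n⇒m⊓n≡m (∸-monoˡ-≤ i₀ (n≤1+n j)))))

    window-end : ∀ {k L} → k + L < length (sub T (suc i₀) (suc j)) → i₀ + k + L < suc j
    window-end {k} {L} k+L<|W| = s≤s (begin
      i₀ + k + L     ≡⟨ +-assoc i₀ k L ⟩
      i₀ + (k + L)   ≤⟨ +-monoʳ-≤ i₀ (≤-pred (subst (k + L <_) length-window k+L<|W|)) ⟩
      i₀ + (j ∸ i₀)  ≡⟨ m+[n∸m]≡n i₀≤j ⟩
      j              ∎)
      where open ≤-Reasoning

    sqs-right-extension-IsMUS : ∀ {v k} → let W = sub T (suc i₀) (suc j) in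
      IsSqs W v → occ v W ≡ 2 → OccursAt v W k → k + length v < length W →
      ¬ (∃[ s′ ] IsMUS T (suc i₀) j s′ (suc i₀ + k + length v)) →
      IsMUS T (suc i₀) (suc j) (suc i₀ + k) (suc i₀ + k + length v)
    sqs-right-extension-IsMUS {v} {k} sqs occ≡2 ok k+|v|<|W| no-IsMUS =
      minimalUnique⇒IsMUS T (sqs-right-extension-mus length-window sqs occ≡2 ok k+|v|<|W| no-mus) refl refl
      where
      no-mus : ¬ (∃[ s ] ∃[ l ] (MinimalUnique (take (j ∸ i₀) (sub T (suc i₀) (suc j))) s l
                                 × s + suc l ≡ suc (k + length v)))
      no-mus (s , l , mu , end) = no-IsMUS (suc i₀ + s ,
        minimalUnique⇒IsMUS T (subst (λ X → MinimalUnique X s l) (sym window-init) mu) refl (begin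
          suc i₀ + k + length v    ≡⟨ +-assoc (suc i₀) k (length v) ⟩
          suc i₀ + (k + length v)  ≡⟨ cong (suc i₀ +_) (suc-injective (trans (sym (+-suc s l)) end)) ⟨
          suc i₀ + (s + l)         ≡⟨ +-assoc (suc i₀) s l ⟨
          suc i₀ + s + l           ∎))
        where open ≡-Reasoning

    lrs-left-extension-IsMUS : ∀ {u k} → let W = sub T (suc i₀) (suc j) in
      IsLrs W u → occ u W ≤ 2 → OccursAt u W k → k + length u < length W →
      ¬ (∃[ t′ ] IsMUS T (suc i₀) j (i₀ + k) t′) → suc (suc i₀) ≤ suc i₀ + k →
      IsMUS T (suc i₀) (suc j) (i₀ + k) (i₀ + k + length u)
    lrs-left-extension-IsMUS {k = zero} _ _ _ _ _ 2+i₀≤1+i₀+0 =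
      contradiction (subst (suc i₀ ≤_) (+-identityʳ i₀) (≤-pred 2+i₀≤1+i₀+0)) (n≮n i₀)
    lrs-left-extension-IsMUS {u} {suc k} lrs occ≤2 ok 1+k+|u|<|W| no-IsMUS _ =
      minimalUnique⇒IsMUS T (lrs-left-extension-mus length-window lrs occ≤2 ok 1+k+|u|<|W| no-mus)
                            (+-suc i₀ k) refl
      where
      no-mus : ¬ (∃[ l ] MinimalUnique (take (j ∸ i₀) (sub T (suc i₀) (suc j))) k l)
      no-mus (l , mu) = no-IsMUS (i₀ + suc k + l ,
        minimalUnique⇒IsMUS T (subst (λ X → MinimalUnique X k l) (sym window-init) mu) (+-suc i₀ k) refl)

lemma6 : {A : Set} (_≟_ : DecidableEquality A) (T : List A) (i j : ℕ) →
    1 ≤ i → i ≤ j → j < length T →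
    (u v : List A) →
    Strings.IsLrs _≟_ (Strings.sub _≟_ T i (suc j)) u →
    Strings.IsSqs _≟_ (Strings.sub _≟_ T i (suc j)) v →
    Strings.occ _≟_ v (Strings.sub _≟_ T i (suc j)) ≡ 2 →
    ∃[ pl ] ∃[ ps ] ∃[ q ]
      (i ≤ pl × pl ≤ ps × ps ≤ q × q < suc j
       × Strings.sub _≟_ T ps q ≡ v
       × Strings.sub _≟_ T pl q ≡ u
       × ((¬ (∃[ s′ ] Strings.IsMUS _≟_ T i j s′ (suc q)))
           → Strings.IsMUS _≟_ T i (suc j) ps (suc q))
       × ((¬ (∃[ t′ ] Strings.IsMUS _≟_ T i j (pl ∸ 1) t′)) → suc i ≤ pl
           → Strings.IsMUS _≟_ T i (suc j) (pl ∸ 1) q))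
lemma6 _≟_ T (suc i₀) j (s≤s z≤n) i<j j<|T| u v lrs sqs occ≡2
  with lrs-sqs-layout _≟_ {Strings.sub _≟_ T (suc i₀) (suc j)} {u} {v} lrs sqs occ≡2
... | k₁ , k₀ , ou , ov , k₁≤k₀ , ends , k₀+|v|<|W| , occ≤2 =
  suc i₀ + k₁ , suc i₀ + k₀ , i₀ + k₀ + length v ,
  m≤m+n (suc i₀) k₁ , +-monoʳ-≤ (suc i₀) k₁≤k₀ ,
  m<m+n (i₀ + k₀) (length-nonempty (proj₁ (proj₂ sqs))) , window-end _≟_ T i₀≤j j<|T| k₀+|v|<|W| ,
  trans (sub-factor _≟_ T {i₀} {suc j} refl refl (fits ov)) (matches ov) ,
  trans (sub-factor _≟_ T {i₀} {suc j} refl (cong suc q≡i₀+k₁+|u|) (fits ou)) (matches ou) ,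
  sqs-right-extension-IsMUS _≟_ T i₀≤j j<|T| sqs occ≡2 ov k₀+|v|<|W| ,
  λ no-IsMUS i<pl → subst (Strings.IsMUS _≟_ T (suc i₀) (suc j) (i₀ + k₁)) (sym q≡i₀+k₁+|u|)
    (lrs-left-extension-IsMUS _≟_ T i₀≤j j<|T| lrs occ≤2 ou (subst (_< length W) ends k₀+|v|<|W|) no-IsMUS i<pl)
  where
  W = Strings.sub _≟_ T (suc i₀) (suc j)
  i₀≤j : i₀ ≤ j
  i₀≤j = <⇒≤ i<j
  q≡i₀+k₁+|u| : i₀ + k₀ + length v ≡ i₀ + k₁ + length u
  q≡i₀+k₁+|u| = trans (+-assoc i₀ k₀ (length v)) (trans (cong (i₀ +_) ends) (sym (+-assoc i₀ k₁ (length u))))
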